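{- Let $COM_{fcn}$ be the theory described in the context. The following six assertions (each understood as universally closed over its free number variables and its free function variables $f,g$, where $f,g$ are unary in (i), binary in (ii)–(iii), and ternary in (iv)–(vi)) are pairwise equivalent over $COM_{fcn}$, i.e. for any two of them, $COM_{fcn}$ together with either one proves the other: (i) $f(0)=g(0)\wedge(\forall n)(f(n)=g(n)\rightarrow f(S(n))=g(S(n)))\rightarrow f(n)=g(n)$; (ii) $f(m,0)=g(m,0)\wedge(\forall n)(f(m,n)=g(m,n)\rightarrow f(m,S(n))=g(m,S(n)))\rightarrow f(m,n)=g(m,n)$; (iii) $f(0,n)=g(0,n)\wedge(\forall m)(f(m,n)=g(m,n)\rightarrow f(S(m),n)=g(S(m),n))\rightarrow f(m,n)=g(m,n)$; (iv) $f(k,m,0)=g(k,m,0)\wedge(\forall n)(f(k,m,n)=g(k,m,n)\rightarrow f(k,m,S(n))=g(k,m,S(n)))\rightarrow f(k,m,n)=g(k,m,n)$; (v) $f(k,0,n)=g(k,0,n)\wedge(\forall m)(f(k,m,n)=g(k,m,n)\rightarrow f(k,S(m),n)=g(k,S(m),n))\rightarrow f(k,m,n)=g(k,m,n)$; (vi) $f(0,m,n)=g(0,m,n)\wedge(\forall k)(f(k,m,n)=g(k,m,n)\rightarrow f(S(k),m,n)=g(S(k),m,n))\rightarrow f(k,m,n)=g(k,m,n)$.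
   Context: The language $L_{fcn}$ is four-sorted: number variables $k,m,n,r,\dots$ ranging over $\omega=\{0,1,2,\dots\}$; function variables of arity 1, 2, 3 ranging over unary, binary, ternary functions on $\omega$; a constant $0$ and a unary function symbol $S$ (successor). Terms are number variables, $0$, $S(t)$, and $f(t)$, $f(t,q)$, $f(t,q,r)$ for terms $t,q,r$ and function variables $f$ of the corresponding arity. Atomic formulas are equations $s=t$ of terms; formulas are built with propositional connectives and quantifiers over numbers and over functions of each arity. Free variables in axioms are read universally. $COM_{fcn}$ consists of the following axioms. (1) Successor axioms: $S(n)\neq 0$; $S(n)=S(m)\rightarrow n=m$; $n\neq 0\rightarrow(\exists m)(S(m)=n)$. (2) Initial function axioms: $(\exists f)(\forall m)(f(m)=n)$ ($f$ unary); $(\exists f)(\forall m,n,r)(f(m,n,r)=m)$, $(\exists f)(\forall m,n,r)(f(m,n,r)=n)$, $(\exists f)(\forall m,n,r)(f(m,n,r)=r)$ ($f$ ternary); $(\exists f)(\forall n)(f(n)=S(n))$ ($f$ unary). (3) Composition axioms: (i) $(\exists f)(\forall m,n,r)(f(m,n,r)=g(m,n))$; (ii) $(\exists f)(\forall m,n,r)(f(m,n,r)=g(m))$; (iii) $(\exists f)(\forall m,n)(f(m,n)=g(m,n,r))$; (iv) $(\exists f)(\forall m)(f(m)=g(m,n,r))$; (v) $(\exists f)(\forall m,n,r)(f(m,n,r)=g(h_1(m,n,r),h_2(m,n,r),h_3(m,n,r)))$, with arities of $f,g,h_i$ as indicated by their arguments. -}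

module Defs where

open import Data.Product using (Σ; _×_; _,_)
open import Data.Fin using (Fin; zero; suc)
open import Relation.Binary.PropositionalEquality using (_≡_; _≢_)

-- A (Henkin, normal) structure for the four-sorted language L_fcn:
-- a number sort N, sorts F1, F2, F3 of unary/binary/ternary "functions"
-- with application maps, the constant 0 and the successor S.
record Structure : Set₁ where
  field
    N   : Set
    F1  : Set
    F2  : Set
    F3  : Set
    z   : N
    S   : N → N
    ap1 : F1 → N → N
    ap2 : F2 → N → N → N
    ap3 : F3 → N → N → N → N

record COM (M : Structure) : Set where
  open Structure M
  field
    S≢0     : ∀ n → S n ≢ z
    S-inj   : ∀ n m → S n ≡ S m → n ≡ m
    S-onto  : ∀ n → n ≢ z → Σ N λ m → S m ≡ n
    const   : ∀ n → Σ F1 λ f → ∀ m → ap1 f m ≡ n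
    proj₁³  : Σ F3 λ f → ∀ m n r → ap3 f m n r ≡ m
    proj₂³  : Σ F3 λ f → ∀ m n r → ap3 f m n r ≡ n
    proj₃³  : Σ F3 λ f → ∀ m n r → ap3 f m n r ≡ r
    succ    : Σ F1 λ f → ∀ n → ap1 f n ≡ S n
    comp-i   : ∀ (g : F2) → Σ F3 λ f → ∀ m n r → ap3 f m n r ≡ ap2 g m n
    comp-ii  : ∀ (g : F1) → Σ F3 λ f → ∀ m n r → ap3 f m n r ≡ ap1 g m
    comp-iii : ∀ (g : F3) r → Σ F2 λ f → ∀ m n → ap2 f m n ≡ ap3 g m n r
    comp-iv  : ∀ (g : F3) n r → Σ F1 λ f → ∀ m → ap1 f m ≡ ap3 g m n r
    comp-v   : ∀ (g h₁ h₂ h₃ : F3) → Σ F3 λ f → ∀ m n r →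
               ap3 f m n r ≡ ap3 g (ap3 h₁ m n r) (ap3 h₂ m n r) (ap3 h₃ m n r)

Ind : Fin 6 → Structure → Set
Ind zero M = let open Structure M in
  ∀ (f g : F1) n →
    (ap1 f z ≡ ap1 g z) × (∀ n → ap1 f n ≡ ap1 g n → ap1 f (S n) ≡ ap1 g (S n)) →
    ap1 f n ≡ ap1 g n
Ind (suc zero) M = let open Structure M in
  ∀ (f g : F2) m n →
    (ap2 f m z ≡ ap2 g m z) ×
    (∀ n → ap2 f m n ≡ ap2 g m n → ap2 f m (S n) ≡ ap2 g m (S n)) →
    ap2 f m n ≡ ap2 g m n
Ind (suc (suc zero)) M = let open Structure M in
  ∀ (f g : F2) m n →
    (ap2 f z n ≡ ap2 g z n) ×
    (∀ m → ap2 f m n ≡ ap2 g m n → ap2 f (S m) n ≡ ap2 g (S m) n) →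
    ap2 f m n ≡ ap2 g m n
Ind (suc (suc (suc zero))) M = let open Structure M in
  ∀ (f g : F3) k m n →
    (ap3 f k m z ≡ ap3 g k m z) ×
    (∀ n → ap3 f k m n ≡ ap3 g k m n → ap3 f k m (S n) ≡ ap3 g k m (S n)) →
    ap3 f k m n ≡ ap3 g k m n
Ind (suc (suc (suc (suc zero)))) M = let open Structure M in
  ∀ (f g : F3) k m n →
    (ap3 f k z n ≡ ap3 g k z n) ×
    (∀ m → ap3 f k m n ≡ ap3 g k m n → ap3 f k (S m) n ≡ ap3 g k (S m) n) →
    ap3 f k m n ≡ ap3 g k m n
Ind (suc (suc (suc (suc (suc zero))))) M = let open Structure M in
  ∀ (f g : F3) k m n →
    (ap3 f z m n ≡ ap3 g z m n) ×
    (∀ k → ap3 f k m n ≡ ap3 g k m n → ap3 f (S k) m n ≡ ap3 g (S k) m n) →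
    ap3 f k m n ≡ ap3 g k m n

{-# OPTIONS --safe #-}
module Submission where

open import Defs
open import Data.Fin using (Fin; zero; suc)
open import Data.Product using (Σ; _×_; _,_; proj₁; proj₂)
open import Data.Unit using (⊤; tt)
open import Function using (_∘_)
open import Relation.Binary.PropositionalEquality

-- Each schema says that induction on one variable holds for every pair of
-- sections of functions of one shape.  The composition axioms make every such
-- section equal to some unary function and, conversely, make every unary
-- function a section of each shape, so all six schemata say the same thing:
-- induction for pairs of unary functions.

pattern unary          = zero
pattern binary-last    = suc zero
pattern binary-first   = suc (suc zero)
pattern ternary-last   = suc (suc (suc zero))
pattern ternary-middle = suc (suc (suc (suc zero)))
pattern ternary-first  = suc (suc (suc (suc (suc zero))))

module _ (M : Structure) where
  open Structure M

  Induction : (N → N) → (N → N) → Set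
  Induction φ ψ = φ z ≡ ψ z → (∀ n → φ n ≡ ψ n → φ (S n) ≡ ψ (S n)) → ∀ n → φ n ≡ ψ n

  Induction-resp : ∀ {φ φ′ ψ ψ′} → φ ≗ φ′ → ψ ≗ ψ′ → Induction φ ψ → Induction φ′ ψ′
  Induction-resp {φ} {φ′} {ψ} {ψ′} φ≗φ′ ψ≗ψ′ ind base step n =
    transfer φ≗φ′ ψ≗ψ′ (ind (transfer φ′≗φ ψ′≗ψ base)
      (λ m → transfer φ′≗φ ψ′≗ψ ∘ step m ∘ transfer φ≗φ′ ψ≗ψ′) n)
    where
    φ′≗φ : φ′ ≗ φ
    φ′≗φ = sym ∘ φ≗φ′
    ψ′≗ψ : ψ′ ≗ ψ
    ψ′≗ψ = sym ∘ ψ≗ψ′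
    transfer : ∀ {α α′ β β′ : N → N} → α ≗ α′ → β ≗ β′ → ∀ {n} → α n ≡ β n → α′ n ≡ β′ n
    transfer α≗α′ β≗β′ {n} eq = trans (sym (α≗α′ n)) (trans eq (β≗β′ n))

  UnaryInduction : Set
  UnaryInduction = ∀ (u v : F1) → Induction (ap1 u) (ap1 v)

  Fun : Fin 6 → Set
  Fun unary          = F1
  Fun binary-last    = F2
  Fun binary-first   = F2
  Fun ternary-last   = F3
  Fun ternary-middle = F3
  Fun ternary-first  = F3

  Params : Fin 6 → Set
  Params unary          = ⊤
  Params binary-last    = N
  Params binary-first   = N
  Params ternary-last   = N × N
  Params ternary-middle = N × N
  Params ternary-first  = N × N

  origin : ∀ j → Params j
  origin unary          = tt
  origin binary-last    = z
  origin binary-first   = z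
  origin ternary-last   = z , z
  origin ternary-middle = z , z
  origin ternary-first  = z , z

  section : ∀ j → Fun j → Params j → N → N
  section unary          f _       x = ap1 f x
  section binary-last    f m       x = ap2 f m x
  section binary-first   f n       x = ap2 f x n
  section ternary-last   f (k , m) x = ap3 f k m x
  section ternary-middle f (k , n) x = ap3 f k x n
  section ternary-first  f (m , n) x = ap3 f x m n

  SectionInduction : Fin 6 → Set
  SectionInduction j = ∀ (f g : Fun j) p → Induction (section j f p) (section j g p)

  Ind⇒SectionInduction : ∀ j → Ind j M → SectionInduction j
  Ind⇒SectionInduction unary          H f g _       b s n = H f g n (b , s)
  Ind⇒SectionInduction binary-last    H f g m       b s n = H f g m n (b , s)
  Ind⇒SectionInduction binary-first   H f g n       b s m = H f g m n (b , s)
  Ind⇒SectionInduction ternary-last   H f g (k , m) b s n = H f g k m n (b , s)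
  Ind⇒SectionInduction ternary-middle H f g (k , n) b s m = H f g k m n (b , s)
  Ind⇒SectionInduction ternary-first  H f g (m , n) b s k = H f g k m n (b , s)

  SectionInduction⇒Ind : ∀ j → SectionInduction j → Ind j M
  SectionInduction⇒Ind unary          H f g n       (b , s) = H f g tt b s n
  SectionInduction⇒Ind binary-last    H f g m n     (b , s) = H f g m b s n
  SectionInduction⇒Ind binary-first   H f g m n     (b , s) = H f g n b s m
  SectionInduction⇒Ind ternary-last   H f g k m n   (b , s) = H f g (k , m) b s n
  SectionInduction⇒Ind ternary-middle H f g k m n   (b , s) = H f g (k , n) b s m
  SectionInduction⇒Ind ternary-first  H f g k m n   (b , s) = H f g (m , n) b s k

  Representable : (N → N) → Set
  Representable φ = Σ F1 λ u → ap1 u ≗ φ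

  Representable-resp : ∀ {φ ψ} → φ ≗ ψ → Representable φ → Representable ψ
  Representable-resp φ≗ψ (u , u≗φ) = u , λ x → trans (u≗φ x) (φ≗ψ x)

  module _ (C : COM M) where
    open COM C

    rotate : F3 → F3
    rotate f = proj₁ (comp-v f (proj₁ proj₂³) (proj₁ proj₃³) (proj₁ proj₁³))

    rotate-ap : ∀ f a b c → ap3 (rotate f) a b c ≡ ap3 f b c a
    rotate-ap f a b c
      rewrite proj₂ (comp-v f (proj₁ proj₂³) (proj₁ proj₃³) (proj₁ proj₁³)) a b c
            | proj₂ proj₂³ a b c | proj₂ proj₃³ a b c | proj₂ proj₁³ a b c = refl

    rotate²-ap : ∀ f a b c → ap3 (rotate (rotate f)) a b c ≡ ap3 f c a b
    rotate²-ap f a b c = trans (rotate-ap (rotate f) a b c) (rotate-ap f b c a)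

    pad₁ : F1 → F3
    pad₁ u = proj₁ (comp-ii u)

    pad₁-ap : ∀ u a b c → ap3 (pad₁ u) a b c ≡ ap1 u a
    pad₁-ap u = proj₂ (comp-ii u)

    pad₂ : F2 → F3
    pad₂ f = proj₁ (comp-i f)

    pad₂-ap : ∀ f a b c → ap3 (pad₂ f) a b c ≡ ap2 f a b
    pad₂-ap f = proj₂ (comp-i f)

    freeze : F3 → N → F2
    freeze f c = proj₁ (comp-iii f c)

    freeze-ap : ∀ f c a b → ap2 (freeze f c) a b ≡ ap3 f a b c
    freeze-ap f c = proj₂ (comp-iii f c)

    first-representable : ∀ f m n → Representable (λ x → ap3 f x m n)
    first-representable f m n = comp-iv f m n

    middle-representable : ∀ f k n → Representable (λ x → ap3 f k x n)
    middle-representable f k n =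
      Representable-resp (λ x → rotate²-ap f x n k) (first-representable (rotate (rotate f)) n k)

    last-representable : ∀ f k m → Representable (λ x → ap3 f k m x)
    last-representable f k m =
      Representable-resp (λ x → rotate-ap f x k m) (first-representable (rotate f) k m)

    section-representable : ∀ j f p → Representable (section j f p)
    section-representable unary          f _       = f , λ _ → refl
    section-representable binary-last    f m       =
      Representable-resp (λ x → pad₂-ap f m x z) (middle-representable (pad₂ f) m z)
    section-representable binary-first   f n       =
      Representable-resp (λ x → pad₂-ap f x n z) (first-representable (pad₂ f) n z)
    section-representable ternary-last   f (k , m) = last-representable f k m
    section-representable ternary-middle f (k , n) = middle-representable f k n
    section-representable ternary-first  f (m , n) = first-representable f m n

    unary-section : ∀ j (u : F1) → Σ (Fun j) λ f → ∀ p → section j f p ≗ ap1 u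
    unary-section unary          u = u , λ _ _ → refl
    unary-section binary-last    u = freeze (rotate (pad₁ u)) z , λ m x →
      trans (freeze-ap (rotate (pad₁ u)) z m x) (trans (rotate-ap (pad₁ u) m x z) (pad₁-ap u x z m))
    unary-section binary-first   u = freeze (pad₁ u) z , λ n x →
      trans (freeze-ap (pad₁ u) z x n) (pad₁-ap u x n z)
    unary-section ternary-last   u = rotate (rotate (pad₁ u)) , λ (k , m) x →
      trans (rotate²-ap (pad₁ u) k m x) (pad₁-ap u x k m)
    unary-section ternary-middle u = rotate (pad₁ u) , λ (k , n) x →
      trans (rotate-ap (pad₁ u) k x n) (pad₁-ap u x n k)
    unary-section ternary-first  u = pad₁ u , λ (m , n) x → pad₁-ap u x m n

    unaryInduction⇒SectionInduction : ∀ j → UnaryInduction → SectionInduction j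
    unaryInduction⇒SectionInduction j H f g p =
      Induction-resp (proj₂ (section-representable j f p)) (proj₂ (section-representable j g p)) (H _ _)

    sectionInduction⇒UnaryInduction : ∀ j → SectionInduction j → UnaryInduction
    sectionInduction⇒UnaryInduction j H u v =
      Induction-resp (proj₂ (unary-section j u) (origin j)) (proj₂ (unary-section j v) (origin j))
        (H (proj₁ (unary-section j u)) (proj₁ (unary-section j v)) (origin j))

lemma2 : (i j : Fin 6) (M : Structure) → COM M → Ind i M → Ind j M
lemma2 i j M C =
  SectionInduction⇒Ind M j
  ∘ unaryInduction⇒SectionInduction M C j
  ∘ sectionInduction⇒UnaryInduction M C i
  ∘ Ind⇒SectionInduction M i
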